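{- Let $m_1,\dots,m_k$ be positive integers. Then there exists a face 2-coloured spherical triangulation whose canonical group is isomorphic to $\mathbb{Z}_{m_1}\oplus\cdots\oplus\mathbb{Z}_{m_k}$.
   Context: A face 2-coloured spherical triangulation is an embedding of a connected graph (loops and multiple edges allowed) in the sphere in which every face is a triangle and the faces are properly coloured black and white (faces sharing an edge have different colours). Let $V$ be its vertex set. The group $\mathcal{A}_W$ is the abelian group generated by $V$ subject to the relations $r+c+s=0$ for every white face with vertices $r,c,s$. It is known that $\mathcal{A}_W\cong\mathbb{Z}\oplus\mathbb{Z}\oplus\mathcal{C}$ with $\mathcal{C}$ a finite abelian group; $\mathcal{C}$ is called the canonical group of the triangulation. (The triangulation in the claim is not required to have a simple underlying graph.) -}

module Defs where

open import Level using (0ℓ)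
open import Data.Nat using (ℕ; zero; suc; _*_; _+_; _<_)
open import Data.Integer as ℤ using (ℤ) renaming (_+_ to _+ℤ_; _*_ to _*ℤ_; _-_ to _-ℤ_)
open import Data.Fin using (Fin; zero; suc; _≟_)
open import Data.Fin.Permutation using (Permutation′; _⟨$⟩ʳ_)
open import Data.Bool using (Bool; true; false; if_then_else_)
open import Data.Product using (Σ; ∃; _×_; _,_)
open import Function.Bundles using (_⇔_)
open import Relation.Nullary using (¬_; does)
open import Relation.Binary.PropositionalEquality using (_≡_; _≢_)
open import Algebra.Bundles.Raw using (RawGroup)
open import Algebra.Morphism.Structures using (module GroupMorphisms)

Σℤ : (r : ℕ) → (Fin r → ℤ) → ℤ
Σℤ zero    f = ℤ.0ℤ
Σℤ (suc r) f = f zero +ℤ Σℤ r (λ j → f (suc j))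

PresEq : (g r : ℕ) → (Fin r → Fin g → ℤ) → (Fin g → ℤ) → (Fin g → ℤ) → Set
PresEq g r R x y =
  ∃ λ (c : Fin r → ℤ) → ∀ (i : Fin g) → x i -ℤ y i ≡ Σℤ r (λ j → c j *ℤ R j i)

Presented : (g r : ℕ) → (Fin r → Fin g → ℤ) → RawGroup 0ℓ 0ℓ
Presented g r R = record
  { Carrier = Fin g → ℤ
  ; _≈_     = PresEq g r R
  ; _∙_     = λ x y i → x i +ℤ y i
  ; ε       = λ _ → ℤ.0ℤ
  ; _⁻¹     = λ x i → ℤ.- x i
  }

_≅_ : RawGroup 0ℓ 0ℓ → RawGroup 0ℓ 0ℓ → Set
G ≅ H = ∃ λ (f : RawGroup.Carrier G → RawGroup.Carrier H) →
          GroupMorphisms.IsGroupIsomorphism G H f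

unit : {g : ℕ} → Fin g → Fin g → ℤ
unit i j = if does (i ≟ j) then ℤ.1ℤ else ℤ.0ℤ

-- ℤ ⊕ ℤ ⊕ ℤ_{m 0} ⊕ ⋯ ⊕ ℤ_{m (k-1)}, presented on generators e_0,e_1,e_{2+i}
-- with relations m i · e_{2+i} = 0
Z²⊕cyclics : (k : ℕ) → (Fin k → ℕ) → RawGroup 0ℓ 0ℓ
Z²⊕cyclics k m =
  Presented (suc (suc k)) k (λ i j → ℤ.+ (m i) *ℤ unit (suc (suc i)) j)

-- Darts (half-edges) Fin d.  σ rotates darts around their origin vertex,
-- α is the fixed-point-free involution swapping the two halves of an edge,
-- φ = σ ∘ α traces the faces; the origins of x, φ x, φ² x are the three
-- corners of the face containing x (in order).

iter : {A : Set} → (A → A) → ℕ → A → A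
iter f zero    a = a
iter f (suc k) a = f (iter f k a)

SameOrbit : {d : ℕ} → (Fin d → Fin d) → Fin d → Fin d → Set
SameOrbit f x y = ∃ λ k → iter f k x ≡ y

data Reach {d : ℕ} (σ α : Fin d → Fin d) (x : Fin d) : Fin d → Set where
  here : Reach σ α x x
  viaσ : ∀ {y} → Reach σ α x y → Reach σ α x (σ y)
  viaα : ∀ {y} → Reach σ α x y → Reach σ α x (α y)

record F2CTriangulation : Set where
  field
    d     : ℕ
    σ     : Permutation′ d
    α     : Permutation′ d
    α-inv : ∀ x → α ⟨$⟩ʳ (α ⟨$⟩ʳ x) ≡ x
    α-fpf : ∀ x → α ⟨$⟩ʳ x ≢ x

  φ : Fin d → Fin d
  φ x = σ ⟨$⟩ʳ (α ⟨$⟩ʳ x)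

  field
    face3   : ∀ x → φ (φ (φ x)) ≡ x
    face≠1  : ∀ x → φ x ≢ x
    connected : ∀ x y → Reach (σ ⟨$⟩ʳ_) (α ⟨$⟩ʳ_) x y
    V       : ℕ
    vert    : Fin d → Fin V
    vert-surj : ∀ v → ∃ λ x → vert x ≡ v
    vert-orb  : ∀ x y → (vert x ≡ vert y) ⇔ SameOrbit (σ ⟨$⟩ʳ_) x y
    -- the surface is the sphere: Euler characteristic V - E + F = 2,
    -- with E = d/2 and F = d/3, i.e. 6V = d + 12
    euler   : 6 * V ≡ d + 12
    -- proper face 2-colouring (true = white), constant on faces
    white       : Fin d → Bool
    white-face  : ∀ x → white (φ x) ≡ white x
    white-proper : ∀ x → white (α ⟨$⟩ʳ x) ≢ white x

  whiteRel : Fin d → Fin V → ℤ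
  whiteRel x i = if white x
    then unit (vert x) i +ℤ (unit (vert (φ x)) i +ℤ unit (vert (φ (φ x))) i)
    else ℤ.0ℤ

  𝒜W : RawGroup 0ℓ 0ℓ
  𝒜W = Presented V d whiteRel

-- Take a bouquet of k + 1 cycles through a common vertex A, the i-th of length 2tᵢ with t₀ = 1
-- and t₁₊ₗ = mₗ, running alternately through vertices aᵢ,q (with aᵢ,₀ = A) and bᵢ,q.  Cone the
-- bouquet to a north pole N and each cycle to its own south pole Sᵢ, and colour the triangles
-- N aᵢ,q bᵢ,q and Sᵢ aᵢ,q₊₁ bᵢ,q white.  In 𝒜_W these faces give bᵢ,q = −N − aᵢ,q and
-- aᵢ,q₊₁ = aᵢ,q + (N − Sᵢ), so every vertex is an integer combination of N, A and the N − Sᵢ,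
-- and closing up the i-th cycle gives the only further relation tᵢ (N − Sᵢ) = 0.
-- Concretely, N ↦ e₀, A ↦ e₁, N − S₁₊ₗ ↦ e₂₊ₗ and its inverse on generators both map relations
-- into relations and compose to the identity modulo relations, so they induce inverse
-- isomorphisms of the presented groups.

module Submission where

open import Defs
open import Level using (0ℓ)
open import Function using (_∘_; _$_)
open import Function.Bundles using (_↔_; Inverse; mk↔ₛ′; mk⇔)
open import Function.Properties.Inverse using (↔-refl; ↔-sym; ↔-trans)
open import Data.Nat as ℕ using (ℕ; zero; suc; _<_; >-nonZero)
open import Data.Nat.Properties using (n<1+n; m≤n⇒∃[o]m+o≡n; +-suc; *-suc; +-comm; suc-pred)
import Data.Nat.Tactic.RingSolver as ℕ-RingSolver
open import Algebra.Definitions.RawMonoid ℕ.+-0-rawMonoid using () renaming (sum to ∑ℕ)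
open import Data.Fin using (Fin; zero; suc; fromℕ; inject₁; toℕ; lift)
open import Data.Fin.Patterns using (0F; 1F; 2F)
open import Data.Fin.Properties using (pigeonhole; toℕ-fromℕ; toℕ-inject₁; +↔⊎; *↔×; 2↔Bool)
open import Data.Fin.Induction using (<-weakInduction; >-weakInduction)
open import Data.Fin.Permutation using (permutation)
open import Data.Integer as ℤ using (ℤ; _+_; _*_; -_; _-_; 0ℤ; 1ℤ; -1ℤ)
open import Data.Integer.Properties
  using (+-*-semiring; -1*i≡-i; *-identityˡ; +-identityˡ; +-identityʳ; +-inverseʳ; *-comm; *-assoc; *-distribʳ-+)
open import Data.Integer.Tactic.RingSolver using (solve-∀)
open import Algebra.Properties.Semiring.Sum +-*-semiring
  using (sum; sum-cong-≗; ∑-distrib-+; ∑-comm; *-distribˡ-sum; *-distribʳ-sum; sum-replicate-zero)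
open import Algebra.Morphism.Structures using (module GroupMorphisms)
open import Data.Bool using (Bool; true; false; if_then_else_)
open import Data.Product using (Σ; ∃; _×_; _,_; proj₁)
open import Data.Product.Function.NonDependent.Propositional using (_×-↔_)
open import Data.Sum using (_⊎_; inj₁; inj₂)
open import Data.Sum.Function.Propositional using (_⊎-↔_)
open import Relation.Binary.Bundles using (Setoid)
open import Relation.Binary.PropositionalEquality
open import Relation.Binary.Construct.Closure.ReflexiveTransitive using (Star; ε; _◅_; _◅◅_)
import Relation.Binary.Reasoning.Setoid as SetoidReasoning

-- Linear maps between free abelian groups

ℤ^_ : ℕ → Set
ℤ^ n = Fin n → ℤ

infixl 6 _⊕_ _⊖_
infixr 7 _·_
infix 8 ⊝_

_⊕_ _⊖_ : ∀ {n} → ℤ^ n → ℤ^ n → ℤ^ n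
(x ⊕ y) i = x i + y i
(x ⊖ y) i = x i - y i

_·_ : ∀ {n} → ℤ → ℤ^ n → ℤ^ n
(a · x) i = a * x i

⊝_ : ∀ {n} → ℤ^ n → ℤ^ n
(⊝ x) i = - x i

0ᵛ : ∀ {n} → ℤ^ n
0ᵛ _ = 0ℤ

Σℤ≡sum : ∀ r (f : ℤ^ r) → Σℤ r f ≡ sum f
Σℤ≡sum zero    f = refl
Σℤ≡sum (suc r) f = cong (_+_ (f zero)) (Σℤ≡sum r (f ∘ suc))

sum-unitˡ : ∀ {n} (v : Fin n) (x : ℤ^ n) → sum (λ w → unit v w * x w) ≡ x v
sum-unitˡ {suc n} zero x = begin
  1ℤ * x zero + sum {n} 0ᵛ  ≡⟨ cong₂ _+_ (*-identityˡ (x zero)) (sum-replicate-zero n) ⟩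
  x zero + 0ℤ               ≡⟨ +-identityʳ (x zero) ⟩
  x zero                    ∎
  where open ≡-Reasoning
sum-unitˡ {suc n} (suc v) x = trans (+-identityˡ _) (sum-unitˡ v (x ∘ suc))

unit-sym : ∀ {n} (v w : Fin n) → unit v w ≡ unit w v
unit-sym zero    zero    = refl
unit-sym zero    (suc w) = refl
unit-sym (suc v) zero    = refl
unit-sym (suc v) (suc w) = unit-sym v w

sum-unitʳ : ∀ {n} (v : Fin n) (x : ℤ^ n) → sum (λ w → x w * unit w v) ≡ x v
sum-unitʳ v x = trans (sum-cong-≗ λ w → trans (*-comm (x w) _) (cong (_* x w) (unit-sym w v)))
                      (sum-unitˡ v x)

linear : ∀ {g g′} → (Fin g → ℤ^ g′) → ℤ^ g → ℤ^ g′
linear f x i = sum (λ v → x v * f v i)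

module _ {g g′ : ℕ} (f : Fin g → ℤ^ g′) where

  linear-cong : ∀ {x y} → x ≗ y → linear f x ≗ linear f y
  linear-cong x≗y i = sum-cong-≗ λ v → cong (_* f v i) (x≗y v)

  linear-0 : linear f 0ᵛ ≗ 0ᵛ
  linear-0 i = sum-replicate-zero g

  linear-⊕ : ∀ x y → linear f (x ⊕ y) ≗ linear f x ⊕ linear f y
  linear-⊕ x y i = trans (sum-cong-≗ λ v → *-distribʳ-+ (f v i) (x v) (y v))
                         (∑-distrib-+ (λ v → x v * f v i) (λ v → y v * f v i))

  linear-· : ∀ a x → linear f (a · x) ≗ a · linear f x
  linear-· a x i = trans (sum-cong-≗ λ v → *-assoc a (x v) (f v i))
                         (sym (*-distribˡ-sum a (λ v → x v * f v i)))

  linear-⊝ : ∀ x → linear f (⊝ x) ≗ ⊝ linear f x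
  linear-⊝ x i = begin
    linear f (⊝ x) i       ≡⟨ linear-cong (λ v → sym (-1*i≡-i (x v))) i ⟩
    linear f (-1ℤ · x) i   ≡⟨ linear-· -1ℤ x i ⟩
    -1ℤ * linear f x i     ≡⟨ -1*i≡-i _ ⟩
    - linear f x i         ∎
    where open ≡-Reasoning

  linear-⊖ : ∀ x y → linear f (x ⊖ y) ≗ linear f x ⊖ linear f y
  linear-⊖ x y i = trans (linear-⊕ x (⊝ y) i) (cong (_+_ (linear f x i)) (linear-⊝ y i))

  linear-unit : ∀ v → linear f (unit v) ≗ f v
  linear-unit v i = sum-unitˡ v (λ w → f w i)

linear-units : ∀ {g} (x : ℤ^ g) → linear unit x ≗ x
linear-units x i = sum-unitʳ i x

linear-⊖-images : ∀ {g g′} (f f′ : Fin g → ℤ^ g′) x →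
            linear (λ v → f v ⊖ f′ v) x ≗ linear f x ⊖ linear f′ x
linear-⊖-images f f′ x i = begin
  sum (λ v → x v * (f v i - f′ v i))
    ≡⟨ sum-cong-≗ (λ v → distrib (x v) (f v i) (f′ v i)) ⟩
  sum (λ v → x v * f v i + -1ℤ * (x v * f′ v i))
    ≡⟨ ∑-distrib-+ (λ v → x v * f v i) (λ v → -1ℤ * (x v * f′ v i)) ⟩
  linear f x i + sum (λ v → -1ℤ * (x v * f′ v i))
    ≡⟨ cong (_+_ (linear f x i)) (sym (*-distribˡ-sum -1ℤ (λ v → x v * f′ v i))) ⟩
  linear f x i + -1ℤ * linear f′ x i
    ≡⟨ cong (_+_ (linear f x i)) (-1*i≡-i _) ⟩
  linear f x i - linear f′ x i
    ∎
  where
    open ≡-Reasoning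
    distrib : ∀ a b c → a * (b - c) ≡ a * b + -1ℤ * (a * c)
    distrib = solve-∀

linear-∘ : ∀ {g g′ g″} (f : Fin g → ℤ^ g′) (h : Fin g′ → ℤ^ g″) x →
           linear h (linear f x) ≗ linear (λ v → linear h (f v)) x
linear-∘ {g} {g′} f h x i = begin
  sum (λ e → sum (λ v → x v * f v e) * h e i)
    ≡⟨ sum-cong-≗ (λ e → *-distribʳ-sum (h e i) (λ v → x v * f v e)) ⟩
  sum (λ e → sum (λ v → x v * f v e * h e i))
    ≡⟨ ∑-comm (λ e v → x v * f v e * h e i) ⟩
  sum (λ v → sum (λ e → x v * f v e * h e i))
    ≡⟨ sum-cong-≗ (λ v → trans (sum-cong-≗ λ e → *-assoc (x v) (f v e) (h e i))
                               (sym (*-distribˡ-sum (x v) (λ e → f v e * h e i)))) ⟩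
  sum (λ v → x v * sum (λ e → f v e * h e i))
    ∎
  where open ≡-Reasoning

-- Subgroups generated by relations, and isomorphisms of presented groups

-- InSpan and _≈[_]_ are records, not type synonyms, so that R, x and y can be inferred.
record InSpan {g r} (R : Fin r → ℤ^ g) (x : ℤ^ g) : Set where
  constructor _,_
  field
    coefficients : Fin r → ℤ
    expansion    : x ≗ linear R coefficients

open InSpan

module _ {g r : ℕ} {R : Fin r → ℤ^ g} where

  span-≗ : ∀ {x y} → x ≗ y → InSpan R x → InSpan R y
  span-≗ x≗y (c , x≗Rc) = c , λ i → trans (sym (x≗y i)) (x≗Rc i)

  span-0 : InSpan R 0ᵛ
  span-0 = 0ᵛ , λ i → sym (linear-0 R i)

  span-gen : ∀ j → InSpan R (R j)
  span-gen j = unit j , λ i → sym (linear-unit R j i)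

  span-⊕ : ∀ {x y} → InSpan R x → InSpan R y → InSpan R (x ⊕ y)
  span-⊕ (c , x≗) (c′ , y≗) =
    c ⊕ c′ , λ i → trans (cong₂ _+_ (x≗ i) (y≗ i)) (sym (linear-⊕ R c c′ i))

  span-⊝ : ∀ {x} → InSpan R x → InSpan R (⊝ x)
  span-⊝ (c , x≗) = ⊝ c , λ i → trans (cong -_ (x≗ i)) (sym (linear-⊝ R c i))

  span-· : ∀ a {x} → InSpan R x → InSpan R (a · x)
  span-· a (c , x≗) = a · c , λ i → trans (cong (a *_) (x≗ i)) (sym (linear-· R a c i))

  span-linear : ∀ {n} (w : Fin n → ℤ^ g) → (∀ j → InSpan R (w j)) → ∀ d → InSpan R (linear w d)
  span-linear w w∈ d = linear (λ j → coefficients (w∈ j)) d , λ i → begin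
    linear w d i                                     ≡⟨ expanded i ⟩
    linear (λ j → linear R (coefficients (w∈ j))) d i ≡⟨ linear-∘ (λ j → coefficients (w∈ j)) R d i ⟨
    linear R (linear (λ j → coefficients (w∈ j)) d) i ∎
    where
      open ≡-Reasoning
      expanded : linear w d ≗ linear (λ j → linear R (coefficients (w∈ j))) d
      expanded i = sum-cong-≗ λ j → cong (d j *_) (expansion (w∈ j) i)

linear-span : ∀ {g g′ r r′} {R : Fin r → ℤ^ g} {R′ : Fin r′ → ℤ^ g′} (f : Fin g → ℤ^ g′) →
              (∀ j → InSpan R′ (linear f (R j))) → ∀ {x} → InSpan R x → InSpan R′ (linear f x)
linear-span {R = R} f fR∈ (c , x≗) =
  span-≗ (λ i → sym (trans (linear-cong f x≗ i) (linear-∘ R f c i))) (span-linear _ fR∈ c)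

infix 4 _≈[_]_

record _≈[_]_ {g r} (x : ℤ^ g) (R : Fin r → ℤ^ g) (y : ℤ^ g) : Set where
  constructor mk≈
  field ⊖∈span : InSpan R (x ⊖ y)

module _ {g r : ℕ} {R : Fin r → ℤ^ g} where

  ≗⇒≈ : ∀ {x y} → x ≗ y → x ≈[ R ] y
  ≗⇒≈ {x} {y} x≗y =
    mk≈ $ span-≗ (λ i → sym (trans (cong (λ z → x i - z) (sym (x≗y i))) (+-inverseʳ (x i)))) span-0

  ≈-refl : ∀ {x} → x ≈[ R ] x
  ≈-refl {x} = ≗⇒≈ {x} {x} λ _ → refl

  ≈-sym : ∀ {x y} → x ≈[ R ] y → y ≈[ R ] x
  ≈-sym {x} {y} (mk≈ x⊖y∈) = mk≈ $ span-≗ (λ i → flip (x i) (y i)) (span-⊝ x⊖y∈)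
    where flip : ∀ a b → - (a - b) ≡ b - a
          flip = solve-∀

  ≈-trans : ∀ {x y z} → x ≈[ R ] y → y ≈[ R ] z → x ≈[ R ] z
  ≈-trans {x} {y} {z} (mk≈ x⊖y∈) (mk≈ y⊖z∈) =
    mk≈ $ span-≗ (λ i → telescope (x i) (y i) (z i)) (span-⊕ x⊖y∈ y⊖z∈)
    where telescope : ∀ a b c → (a - b) + (b - c) ≡ a - c
          telescope = solve-∀

  ≈-⊕ : ∀ {x x′ y y′} → x ≈[ R ] x′ → y ≈[ R ] y′ → x ⊕ y ≈[ R ] x′ ⊕ y′
  ≈-⊕ {x} {x′} {y} {y′} (mk≈ x⊖x′∈) (mk≈ y⊖y′∈) =
    mk≈ $ span-≗ (λ i → interchange (x i) (x′ i) (y i) (y′ i)) (span-⊕ x⊖x′∈ y⊖y′∈)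
    where interchange : ∀ a a′ b b′ → (a - a′) + (b - b′) ≡ (a + b) - (a′ + b′)
          interchange = solve-∀

  ≈-· : ∀ a {x y} → x ≈[ R ] y → a · x ≈[ R ] a · y
  ≈-· a {x} {y} (mk≈ x⊖y∈) = mk≈ $ span-≗ (λ i → distrib a (x i) (y i)) (span-· a x⊖y∈)
    where distrib : ∀ a b c → a * (b - c) ≡ a * b - a * c
          distrib = solve-∀

  ≈-⊝ : ∀ {x y} → x ≈[ R ] y → ⊝ x ≈[ R ] ⊝ y
  ≈-⊝ {x} {y} (mk≈ x⊖y∈) = mk≈ $ span-≗ (λ i → distrib (x i) (y i)) (span-⊝ x⊖y∈)
    where distrib : ∀ a b → - (a - b) ≡ - a - - b
          distrib = solve-∀

  ≈0⇒InSpan : ∀ {x} → x ≈[ R ] 0ᵛ → InSpan R x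
  ≈0⇒InSpan {x} (mk≈ x⊖0∈) = span-≗ (λ i → +-identityʳ (x i)) x⊖0∈

  ≈-setoid : Setoid 0ℓ 0ℓ
  ≈-setoid = record
    { Carrier       = ℤ^ g
    ; _≈_           = _≈[ R ]_
    ; isEquivalence = record
      { refl  = λ {x} → ≈-refl {x}
      ; sym   = λ {x} {y} → ≈-sym {x} {y}
      ; trans = λ {x} {y} {z} → ≈-trans {x} {y} {z}
      }
    }

  ≈⇒PresEq : ∀ {x y} → x ≈[ R ] y → PresEq g r R x y
  ≈⇒PresEq (mk≈ (c , x⊖y≗)) = c , λ i → trans (x⊖y≗ i) (sym (Σℤ≡sum r (λ j → c j * R j i)))

  PresEq⇒≈ : ∀ {x y} → PresEq g r R x y → x ≈[ R ] y
  PresEq⇒≈ (c , x⊖y≡) = mk≈ $ c , λ i → trans (x⊖y≡ i) (Σℤ≡sum r (λ j → c j * R j i))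

module _ {g g′ r r′ : ℕ} {R : Fin r → ℤ^ g} {R′ : Fin r′ → ℤ^ g′} where

  linear-resp-≈ : (f : Fin g → ℤ^ g′) → (∀ j → InSpan R′ (linear f (R j))) →
                  ∀ {x y} → x ≈[ R ] y → linear f x ≈[ R′ ] linear f y
  linear-resp-≈ f fR∈ {x} {y} (mk≈ x⊖y∈) = mk≈ $ span-≗ (linear-⊖ f x y) (linear-span f fR∈ x⊖y∈)

linear-inverse : ∀ {g g′ r} {R : Fin r → ℤ^ g} (f : Fin g → ℤ^ g′) (h : Fin g′ → ℤ^ g) →
                 (∀ v → linear h (f v) ≈[ R ] unit v) → ∀ x → linear h (linear f x) ≈[ R ] x
linear-inverse f h hf≈ x =
  mk≈ $ span-≗ roundtrip (span-linear (λ v → linear h (f v) ⊖ unit v) (_≈[_]_.⊖∈span ∘ hf≈) x)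
  where
    roundtrip : linear (λ v → linear h (f v) ⊖ unit v) x ≗ linear h (linear f x) ⊖ x
    roundtrip i = trans (linear-⊖-images (λ v → linear h (f v)) unit x i)
                        (cong₂ _-_ (sym (linear-∘ f h x i)) (linear-units x i))

module _ {g r g′ r′ : ℕ} {R : Fin r → ℤ^ g} {R′ : Fin r′ → ℤ^ g′}
         (f : Fin g → ℤ^ g′) (h : Fin g′ → ℤ^ g)
         (fR∈ : ∀ j → InSpan R′ (linear f (R j)))
         (hR′∈ : ∀ l → InSpan R (linear h (R′ l)))
         (hf≈ : ∀ v → linear h (f v) ≈[ R ] unit v)
         (fh≈ : ∀ e → linear f (h e) ≈[ R′ ] unit e) where

  open GroupMorphisms (Presented g r R) (Presented g′ r′ R′)

  private
    injective : ∀ {x y} → linear f x ≈[ R′ ] linear f y → x ≈[ R ] y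
    injective {x} {y} fx≈fy = begin
      x                         ≈⟨ linear-inverse f h hf≈ x ⟨
      linear h (linear f x)     ≈⟨ linear-resp-≈ h hR′∈ fx≈fy ⟩
      linear h (linear f y)     ≈⟨ linear-inverse f h hf≈ y ⟩
      y                         ∎
      where open SetoidReasoning (≈-setoid {R = R})

    surjective : ∀ y {z} → z ≈[ R ] linear h y → linear f z ≈[ R′ ] y
    surjective y {z} z≈hy = begin
      linear f z                ≈⟨ linear-resp-≈ f fR∈ z≈hy ⟩
      linear f (linear h y)     ≈⟨ linear-inverse h f fh≈ y ⟩
      y                         ∎
      where open SetoidReasoning (≈-setoid {R = R′})

  linear-isGroupIsomorphism : IsGroupIsomorphism (linear f)
  linear-isGroupIsomorphism = record
    { isGroupMonomorphism = record
      { isGroupHomomorphism = record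
        { isMonoidHomomorphism = record
          { isMagmaHomomorphism = record
            { isRelHomomorphism = record
              { cong = λ {x} {y} → ≈⇒PresEq ∘ linear-resp-≈ f fR∈ ∘ PresEq⇒≈ {x = x} {y} }
            ; homo = λ x y → ≈⇒PresEq (≗⇒≈ {x = linear f (x ⊕ y)} (linear-⊕ f x y))
            }
          ; ε-homo = ≈⇒PresEq (≗⇒≈ {x = linear f 0ᵛ} (linear-0 f))
          }
        ; ⁻¹-homo = λ x → ≈⇒PresEq (≗⇒≈ {x = linear f (⊝ x)} (linear-⊝ f x))
        }
      ; injective = λ {x} {y} → ≈⇒PresEq ∘ injective {x} {y} ∘ PresEq⇒≈
      }
    ; surjective = λ y → linear h y , λ {z} → ≈⇒PresEq ∘ surjective y ∘ PresEq⇒≈ {x = z}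
    }

  Presented-≅ : Presented g r R ≅ Presented g′ r′ R′
  Presented-≅ = linear f , linear-isGroupIsomorphism


-- Orbits and reachability for injective maps on Fin d

iter-+ : ∀ {A : Set} (f : A → A) m n x → iter f (m ℕ.+ n) x ≡ iter f m (iter f n x)
iter-+ f zero    n x = refl
iter-+ f (suc m) n x = cong f (iter-+ f m n x)

iter-injective : ∀ {A : Set} {f : A → A} → (∀ {x y} → f x ≡ f y → x ≡ y) →
                 ∀ n {x y} → iter f n x ≡ iter f n y → x ≡ y
iter-injective f-inj zero    eq = eq
iter-injective f-inj (suc n) eq = iter-injective f-inj n (f-inj eq)

iter-*-fixed : ∀ {A : Set} (f : A → A) {p x} → iter f p x ≡ x → ∀ n → iter f (n ℕ.* p) x ≡ x
iter-*-fixed f         fixed zero    = refl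
iter-*-fixed f {p} {x} fixed (suc n) = begin
  iter f (p ℕ.+ n ℕ.* p) x        ≡⟨ iter-+ f p (n ℕ.* p) x ⟩
  iter f p (iter f (n ℕ.* p) x) ≡⟨ cong (iter f p) (iter-*-fixed f fixed n) ⟩
  iter f p x                  ≡⟨ fixed ⟩
  x                           ∎
  where open ≡-Reasoning

module _ {d : ℕ} {f : Fin d → Fin d} (f-inj : ∀ {x y} → f x ≡ f y → x ≡ y) where

  -- pigeonhole on x, f x, …, fᵈ x gives fⁱ x ≡ fʲ x with i < j; cancel fⁱ
  periodic : ∀ x → ∃ λ p → iter f (suc p) x ≡ x
  periodic x with pigeonhole (n<1+n d) (λ i → iter f (toℕ i) x)
  ... | i , j , i<j , fⁱx≡fʲx with m≤n⇒∃[o]m+o≡n i<j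
  ... | o , i+1+o≡j = o , iter-injective f-inj (toℕ i) (begin
    iter f (toℕ i) (iter f (suc o) x) ≡⟨ iter-+ f (toℕ i) (suc o) x ⟨
    iter f (toℕ i ℕ.+ suc o) x          ≡⟨ cong (λ n → iter f n x) (trans (+-suc (toℕ i) o) i+1+o≡j) ⟩
    iter f (toℕ j) x                  ≡⟨ fⁱx≡fʲx ⟨
    iter f (toℕ i) x                  ∎)
    where open ≡-Reasoning

  SameOrbit-sym : ∀ {x y} → SameOrbit f x y → SameOrbit f y x
  SameOrbit-sym {x} (n , refl) with periodic x
  ... | p , fixed = n ℕ.* p , (begin
    iter f (n ℕ.* p) (iter f n x) ≡⟨ iter-+ f (n ℕ.* p) n x ⟨
    iter f (n ℕ.* p ℕ.+ n) x        ≡⟨ cong (λ k → iter f k x) (trans (*-suc n p) (+-comm n (n ℕ.* p))) ⟨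
    iter f (n ℕ.* suc p) x        ≡⟨ iter-*-fixed f fixed n ⟩
    x                           ∎)
    where open ≡-Reasoning

SameOrbit-trans : ∀ {d} {f : Fin d → Fin d} {x y z} → SameOrbit f x y → SameOrbit f y z → SameOrbit f x z
SameOrbit-trans {f = f} {x} (m , fᵐx≡y) (n , fⁿy≡z) =
  n ℕ.+ m , trans (iter-+ f n m x) (trans (cong (iter f n) fᵐx≡y) fⁿy≡z)

module _ {d : ℕ} {σ α : Fin d → Fin d} where

  Reach-trans : ∀ {x y z} → Reach σ α x y → Reach σ α y z → Reach σ α x z
  Reach-trans p here     = p
  Reach-trans p (viaσ q) = viaσ (Reach-trans p q)
  Reach-trans p (viaα q) = viaα (Reach-trans p q)

  iter⇒Reach : ∀ n x → Reach σ α x (iter σ n x)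
  iter⇒Reach zero    x = here
  iter⇒Reach (suc n) x = viaσ (iter⇒Reach n x)

  Reach-sym : (∀ {x y} → σ x ≡ σ y → x ≡ y) → (∀ x → α (α x) ≡ x) →
              ∀ {x y} → Reach σ α x y → Reach σ α y x
  Reach-sym σ-inj α-inv here              = here
  Reach-sym σ-inj α-inv (viaσ {y} p) with SameOrbit-sym σ-inj (1 , refl)
  ... | n , σⁿσy≡y =
    Reach-trans (subst (Reach σ α (σ y)) σⁿσy≡y (iter⇒Reach n (σ y))) (Reach-sym σ-inj α-inv p)
  Reach-sym σ-inj α-inv (viaα {y} p) =
    Reach-trans (subst (Reach σ α (α y)) (α-inv y) (viaα here)) (Reach-sym σ-inj α-inv p)


-- Face 2-coloured triangulations on arbitrary finite types

Path : {A : Set} → (A → A) → A → A → Set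
Path f = Star (λ x y → f x ≡ y)

-- Only one direction of each σ-orbit and of connectivity is required: since the darts are
-- finite, SameOrbit-sym recovers the other one after transport to Fin d.
record F2CTriangulationOn (Dart Vertex : Set) : Set where
  field
    φ α          : Dart → Dart
    φ³≡id        : ∀ x → φ (φ (φ x)) ≡ x
    φ-fpf        : ∀ x → φ x ≢ x
    α-involutive : ∀ x → α (α x) ≡ x
    α-fpf        : ∀ x → α x ≢ x

  σ : Dart → Dart
  σ x = φ (α x)

  field
    vert             : Dart → Vertex
    vert-σ           : ∀ x → vert (σ x) ≡ vert x
    corner           : Vertex → Dart
    vert-corner      : ∀ v → vert (corner v) ≡ v
    rotate-to-corner : ∀ x → Path σ x (corner (vert x))
    root             : Dart
    reach-root       : ∀ x → Star (λ y z → φ y ≡ z ⊎ α y ≡ z) x root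
    white            : Dart → Bool
    white-φ          : ∀ x → white (φ x) ≡ white x
    white-α          : ∀ x → white (α x) ≢ white x

  σ⁻¹ : Dart → Dart
  σ⁻¹ x = α (φ (φ x))

  σ-σ⁻¹ : ∀ x → σ (σ⁻¹ x) ≡ x
  σ-σ⁻¹ x = trans (cong φ (α-involutive (φ (φ x)))) (φ³≡id x)

  σ⁻¹-σ : ∀ x → σ⁻¹ (σ x) ≡ x
  σ⁻¹-σ x = trans (cong α (φ³≡id (α x))) (α-involutive x)

module Transport {Dart Vertex : Set} {d n : ℕ} (Dart↔ : Dart ↔ Fin d) (Vertex↔ : Vertex ↔ Fin n)
         (M : F2CTriangulationOn Dart Vertex) where

  open F2CTriangulationOn M
  private
    module D = Inverse Dart↔
    module W = Inverse Vertex↔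

  conj : (Dart → Dart) → Fin d → Fin d
  conj f x = D.to (f (D.from x))

  private
    from-conj : ∀ f x → D.from (conj f x) ≡ f (D.from x)
    from-conj f x = D.strictlyInverseʳ (f (D.from x))

    conj-to : ∀ f y → conj f (D.to y) ≡ D.to (f y)
    conj-to f y = cong (D.to ∘ f) (D.strictlyInverseʳ y)

    conj-inverse : ∀ f g → (∀ y → f (g y) ≡ y) → ∀ x → conj f (conj g x) ≡ x
    conj-inverse f g fg x = trans (conj-to f (g (D.from x))) (trans (cong D.to (fg _)) (D.strictlyInverseˡ x))

    conj-fpf : ∀ {f} → (∀ y → f y ≢ y) → ∀ x → conj f x ≢ x
    conj-fpf {f} fpf x eq = fpf (D.from x) (trans (sym (from-conj f x)) (cong D.from eq))

    φ′ : Fin d → Fin d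
    φ′ x = conj σ (conj α x)

    φ′≡conj-φ : ∀ x → φ′ x ≡ conj φ x
    φ′≡conj-φ x = trans (conj-to σ (α (D.from x))) (cong (D.to ∘ φ) (α-involutive (D.from x)))

    from-φ′ : ∀ x → D.from (φ′ x) ≡ φ (D.from x)
    from-φ′ x = trans (cong D.from (φ′≡conj-φ x)) (from-conj φ x)

    to-injective : ∀ {v w} → W.to v ≡ W.to w → v ≡ w
    to-injective {v} {w} eq = trans (sym (W.strictlyInverseʳ v)) (trans (cong W.from eq) (W.strictlyInverseʳ w))

    φ′³ : ∀ x → φ′ (φ′ (φ′ x)) ≡ x
    φ′³ x = begin
      φ′ (φ′ (φ′ x))             ≡⟨ cong (φ′ ∘ φ′) (φ′≡conj-φ x) ⟩
      φ′ (φ′ (conj φ x))         ≡⟨ cong φ′ (φ′≡conj-φ _) ⟩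
      φ′ (conj φ (conj φ x))     ≡⟨ φ′≡conj-φ _ ⟩
      conj φ (conj φ (conj φ x)) ≡⟨ cong (conj φ) (conj-to φ (φ (D.from x))) ⟩
      conj φ (conj (φ ∘ φ) x)    ≡⟨ conj-inverse φ (φ ∘ φ) φ³≡id x ⟩
      x                          ∎
      where open ≡-Reasoning

    vert′ : Fin d → Fin n
    vert′ x = W.to (vert (D.from x))

    path⇒SameOrbit : ∀ {x y} → Path σ x y → SameOrbit (conj σ) (D.to x) (D.to y)
    path⇒SameOrbit ε                    = 0 , refl
    path⇒SameOrbit {x} (refl ◅ σ-path) = SameOrbit-trans (1 , conj-to σ x) (path⇒SameOrbit σ-path)

    conj-σ-injective : ∀ {x y} → conj σ x ≡ conj σ y → x ≡ y
    conj-σ-injective {x} {y} eq =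
      trans (sym (conj-inverse σ⁻¹ σ σ⁻¹-σ x)) (trans (cong (conj σ⁻¹) eq) (conj-inverse σ⁻¹ σ σ⁻¹-σ y))

    same-vertex⇒SameOrbit : ∀ x y → vert′ x ≡ vert′ y → SameOrbit (conj σ) x y
    same-vertex⇒SameOrbit x y eq = subst₂ (SameOrbit (conj σ)) (D.strictlyInverseˡ x) (D.strictlyInverseˡ y)
      (SameOrbit-trans (path⇒SameOrbit (rotate-to-corner (D.from x)))
        (SameOrbit-sym conj-σ-injective
          (subst (λ v → SameOrbit (conj σ) (D.to (D.from y)) (D.to (corner v)))
                 (sym (to-injective eq)) (path⇒SameOrbit (rotate-to-corner (D.from y))))))

    vert′-iter : ∀ k x → vert′ (iter (conj σ) k x) ≡ vert′ x
    vert′-iter zero    x = refl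
    vert′-iter (suc k) x =
      trans (cong (W.to ∘ vert) (from-conj σ (iter (conj σ) k x))) (trans (cong W.to (vert-σ _)) (vert′-iter k x))

    SameOrbit⇒same-vertex : ∀ x y → SameOrbit (conj σ) x y → vert′ x ≡ vert′ y
    SameOrbit⇒same-vertex x y (k , refl) = sym (vert′-iter k x)

    step⇒Reach : ∀ {x y} → φ x ≡ y ⊎ α x ≡ y → Reach (conj σ) (conj α) (D.to x) (D.to y)
    step⇒Reach {x} (inj₁ refl) =
      subst (Reach (conj σ) (conj α) (D.to x)) (trans (φ′≡conj-φ (D.to x)) (conj-to φ x)) (viaσ (viaα here))
    step⇒Reach {x} (inj₂ refl) = subst (Reach (conj σ) (conj α) (D.to x)) (conj-to α x) (viaα here)

    star⇒Reach : ∀ {x y} → Star (λ y z → φ y ≡ z ⊎ α y ≡ z) x y →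
                 Reach (conj σ) (conj α) (D.to x) (D.to y)
    star⇒Reach ε          = here
    star⇒Reach (s ◅ path) = Reach-trans (step⇒Reach s) (star⇒Reach path)

    reach-root′ : ∀ x → Reach (conj σ) (conj α) x (D.to root)
    reach-root′ x = subst (λ z → Reach (conj σ) (conj α) z (D.to root)) (D.strictlyInverseˡ x)
                          (star⇒Reach (reach-root (D.from x)))

    connected′ : ∀ x y → Reach (conj σ) (conj α) x y
    connected′ x y =
      Reach-trans (reach-root′ x) (Reach-sym conj-σ-injective (conj-inverse α α α-involutive) (reach-root′ y))

  toF2CTriangulation : 6 ℕ.* n ≡ d ℕ.+ 12 → F2CTriangulation
  toF2CTriangulation euler = record
    { d            = d
    ; σ            = permutation (conj σ) (conj σ⁻¹) (conj-inverse σ σ⁻¹ σ-σ⁻¹) (conj-inverse σ⁻¹ σ σ⁻¹-σ)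
    ; α            = permutation (conj α) (conj α) (conj-inverse α α α-involutive)
                                 (conj-inverse α α α-involutive)
    ; α-inv        = conj-inverse α α α-involutive
    ; α-fpf        = conj-fpf α-fpf
    ; face3        = φ′³
    ; face≠1       = λ x → subst (_≢ x) (sym (φ′≡conj-φ x)) (conj-fpf φ-fpf x)
    ; connected    = connected′
    ; V            = n
    ; vert         = vert′
    ; vert-surj    = λ v → D.to (corner (W.from v)) ,
                     trans (cong (W.to ∘ vert) (D.strictlyInverseʳ _))
                           (trans (cong W.to (vert-corner _)) (W.strictlyInverseˡ v))
    ; vert-orb     = λ x y → mk⇔ (same-vertex⇒SameOrbit x y) (SameOrbit⇒same-vertex x y)
    ; euler        = euler
    ; white        = white ∘ D.from
    ; white-face   = λ x → trans (cong white (from-φ′ x)) (white-φ (D.from x))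
    ; white-proper = λ x → subst (_≢ white (D.from x)) (cong white (sym (from-conj α x))) (white-α (D.from x))
    }

  ⟦_⟧ : Vertex → ℤ^ n
  ⟦ v ⟧ = unit (W.to v)

  faceRelation : Dart → ℤ^ n
  faceRelation y i = if white y then ⟦ vert y ⟧ i + (⟦ vert (φ y) ⟧ i + ⟦ vert (φ (φ y)) ⟧ i) else 0ℤ

  module _ (euler : 6 ℕ.* n ≡ d ℕ.+ 12) where

    open F2CTriangulation (toF2CTriangulation euler) using (whiteRel)

    whiteRel≗faceRelation : ∀ x → whiteRel x ≗ faceRelation (D.from x)
    whiteRel≗faceRelation x i =
      cong₂ (λ y z → if white (D.from x) then ⟦ vert (D.from x) ⟧ i + (⟦ vert y ⟧ i + ⟦ vert z ⟧ i) else 0ℤ)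
            (from-φ′ x) (trans (from-φ′ (φ′ x)) (cong φ (from-φ′ x)))

    faceRelation∈span : ∀ y → InSpan whiteRel (faceRelation y)
    faceRelation∈span y = span-≗ (λ i → trans (whiteRel≗faceRelation (D.to y) i)
                                             (cong (λ z → faceRelation z i) (D.strictlyInverseʳ y)))
                                 (span-gen (D.to y))

  faceRelation-φ : ∀ y → faceRelation (φ y) ≗ faceRelation y
  faceRelation-φ y i rewrite white-φ y | φ³≡id y with white y
  ... | true  = rotate (⟦ vert y ⟧ i) (⟦ vert (φ y) ⟧ i) (⟦ vert (φ (φ y)) ⟧ i)
    where rotate : ∀ u v w → v + (w + u) ≡ u + (v + w)
          rotate = solve-∀
  ... | false = refl


next : ∀ {n} → Fin (suc n) → Fin (suc n)
next {zero}  zero    = zero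
next {suc n} zero    = suc zero
next {suc n} (suc i) = lift 1 suc (next i)

prev : ∀ {n} → Fin (suc n) → Fin (suc n)
prev {n} zero = fromℕ n
prev (suc i)  = inject₁ i

next-fromℕ : ∀ n → next (fromℕ n) ≡ zero
next-fromℕ zero    = refl
next-fromℕ (suc n) = cong (lift 1 suc) (next-fromℕ n)

next-inject₁ : ∀ {n} (i : Fin n) → next (inject₁ i) ≡ suc i
next-inject₁ {suc n} zero    = refl
next-inject₁ {suc n} (suc i) = cong (lift 1 suc) (next-inject₁ i)

next-prev : ∀ {n} (i : Fin (suc n)) → next (prev i) ≡ i
next-prev {n} zero = next-fromℕ n
next-prev (suc i)  = next-inject₁ i

prev-next : ∀ {n} (i : Fin (suc n)) → prev (next i) ≡ i
prev-next {zero}  zero    = refl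
prev-next {suc n} zero    = refl
prev-next {suc n} (suc i) with next i | prev-next i
... | zero  | prev-zero≡i = cong suc prev-zero≡i
... | suc j | prev-sucj≡i = cong suc prev-sucj≡i

toℕ-next : ∀ {n} (i : Fin (suc n)) → (next i ≡ zero × toℕ i ≡ n) ⊎ toℕ (next i) ≡ suc (toℕ i)
toℕ-next {n} i with next i in eq
... | zero  = inj₁ (refl , trans (cong toℕ (trans (sym (prev-next i)) (cong prev eq))) (toℕ-fromℕ n))
... | suc j = inj₂ (cong suc (trans (sym (toℕ-inject₁ j)) (cong toℕ (trans (sym (cong prev eq)) (prev-next i)))))


-- The bouquet triangulation

Σ-Fin↔ : ∀ {K} (t : Fin K → ℕ) → Σ (Fin K) (Fin ∘ t) ↔ Fin (∑ℕ t)
Σ-Fin↔ {zero}  t = mk↔ₛ′ (λ { (() , _) }) (λ ()) (λ ()) (λ { (() , _) })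
Σ-Fin↔ {suc K} t = ↔-trans split (↔-trans (↔-refl ⊎-↔ Σ-Fin↔ (t ∘ suc)) (↔-sym +↔⊎))
  where
    split : Σ (Fin (suc K)) (Fin ∘ t) ↔ (Fin (t zero) ⊎ Σ (Fin K) (Fin ∘ t ∘ suc))
    split = mk↔ₛ′ (λ { (zero , q) → inj₁ q ; (suc i , q) → inj₂ (i , q) })
                  (λ { (inj₁ q) → zero , q ; (inj₂ (i , q)) → suc i , q })
                  (λ { (inj₁ q) → refl ; (inj₂ (i , q)) → refl })
                  (λ { (zero , q) → refl ; (suc i , q) → refl })

data Pole : Set where
  north south : Pole

Pole↔Bool : Pole ↔ Bool
Pole↔Bool = mk↔ₛ′ (λ { north → true ; south → false }) (λ { true → north ; false → south })
                  (λ { true → refl ; false → refl }) (λ { north → refl ; south → refl })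

Location : Set
Location = Pole × Bool × Fin 3

Location↔ : Location ↔ Fin 12
Location↔ = ↔-trans (↔-trans Pole↔Bool (↔-sym 2↔Bool) ×-↔ (↔-sym 2↔Bool ×-↔ ↔-refl))
                    (↔-trans (↔-refl ×-↔ ↔-sym *↔×) (↔-sym *↔×))

rotate : Fin 3 → Fin 3
rotate 0F = 1F
rotate 1F = 2F
rotate 2F = 0F

-- Petal i has the cells (i , q), q ≤ p i, and its rim is the cycle A = a (i , 0), b (i , 0),
-- a (i , 1), …, b (i , p i), A.  The cell (i , q) carries the four triangles N a b, N b a-next,
-- Sᵢ b a, Sᵢ a-next b, where a = a (i , q), b = b (i , q), a-next = a (i , q + 1 mod (p i + 1));
-- a dart is located by its cell, pole, colour (true = white) and corner, corners numbered in
-- φ-order.  In Vertex, the slot ((i , 0) , false) holds Sᵢ and ((i , q + 1) , false) holds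
-- a (i , q + 1).
module Bouquet {k : ℕ} (p : Fin (suc k) → ℕ) where

  Cell : Set
  Cell = Σ (Fin (suc k)) (λ i → Fin (suc (p i)))

  Dart : Set
  Dart = Cell × Location

  Vertex : Set
  Vertex = Fin 2 ⊎ Cell × Bool

  pattern N         = inj₁ 0F
  pattern A         = inj₁ 1F
  pattern S i       = inj₂ ((i , zero) , false)
  pattern a-suc i j = inj₂ ((i , suc j) , false)
  pattern b c       = inj₂ (c , true)

  a : Cell → Vertex
  a (i , zero)  = A
  a (i , suc j) = a-suc i j

  a-next : Cell → Vertex
  a-next (i , q) = a (i , next q)

  carry : (i : Fin (suc k)) → Fin (suc (p i)) → Cell
  carry i zero    = next i , zero
  carry i (suc j) = i , suc j

  -- the cyclic order of the cells around N runs through petal 0, then petal 1, and so on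
  nextCell : Cell → Cell
  nextCell (i , q) = carry i (next q)

  prevCell : Cell → Cell
  prevCell (i , zero)  = prev i , fromℕ (p (prev i))
  prevCell (i , suc j) = i , inject₁ j

  prevCell-carry : ∀ i q → prevCell (carry i q) ≡ (i , prev q)
  prevCell-carry i zero    rewrite prev-next i = refl
  prevCell-carry i (suc j) = refl

  prevCell-nextCell : ∀ c → prevCell (nextCell c) ≡ c
  prevCell-nextCell (i , q) = trans (prevCell-carry i (next q)) (cong (i ,_) (prev-next q))

  nextCell-prevCell : ∀ c → nextCell (prevCell c) ≡ c
  nextCell-prevCell (i , zero)  rewrite next-fromℕ (p (prev i)) = cong (_, zero) (next-prev i)
  nextCell-prevCell (i , suc j) = cong (carry i) (next-inject₁ j)

  φ : Dart → Dart
  φ (c , pole , w , corner) = c , pole , w , rotate corner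

  α : Dart → Dart
  α (c       , north , true  , 0F) = prevCell c , north , false , 2F
  α (c       , north , true  , 1F) = c          , south , false , 1F
  α (c       , north , true  , 2F) = c          , north , false , 0F
  α (c       , north , false , 0F) = c          , north , true  , 2F
  α (c       , north , false , 1F) = c          , south , true  , 1F
  α (c       , north , false , 2F) = nextCell c , north , true  , 0F
  α (c       , south , false , 0F) = c          , south , true  , 2F
  α (c       , south , false , 1F) = c          , north , true  , 1F
  α ((i , q) , south , false , 2F) = (i , prev q) , south , true , 0F
  α ((i , q) , south , true  , 0F) = (i , next q) , south , false , 2F
  α (c       , south , true  , 1F) = c          , north , false , 1F
  α (c       , south , true  , 2F) = c          , south , false , 0F

  vert : Dart → Vertex
  vert (c       , north , _     , 0F) = N
  vert (c       , north , true  , 1F) = a c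
  vert (c       , north , true  , 2F) = b c
  vert (c       , north , false , 1F) = b c
  vert (c       , north , false , 2F) = a-next c
  vert ((i , q) , south , _     , 0F) = S i
  vert (c       , south , false , 1F) = b c
  vert (c       , south , false , 2F) = a c
  vert (c       , south , true  , 1F) = a-next c
  vert (c       , south , true  , 2F) = b c

  white : Dart → Bool
  white (_ , _ , w , _) = w

  σ : Dart → Dart
  σ x = φ (α x)

  φ³≡id : ∀ x → φ (φ (φ x)) ≡ x
  φ³≡id (_ , _ , _ , 0F) = refl
  φ³≡id (_ , _ , _ , 1F) = refl
  φ³≡id (_ , _ , _ , 2F) = refl

  φ-fpf : ∀ x → φ x ≢ x
  φ-fpf (_ , _ , _ , 0F) ()
  φ-fpf (_ , _ , _ , 1F) ()
  φ-fpf (_ , _ , _ , 2F) ()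

  α-involutive : ∀ x → α (α x) ≡ x
  α-involutive (c       , north , true  , 0F) = cong (λ c → c , north , true , 0F) (nextCell-prevCell c)
  α-involutive (c       , north , true  , 1F) = refl
  α-involutive (c       , north , true  , 2F) = refl
  α-involutive (c       , north , false , 0F) = refl
  α-involutive (c       , north , false , 1F) = refl
  α-involutive (c       , north , false , 2F) = cong (λ c → c , north , false , 2F) (prevCell-nextCell c)
  α-involutive (c       , south , false , 0F) = refl
  α-involutive (c       , south , false , 1F) = refl
  α-involutive ((i , q) , south , false , 2F) = cong (λ q → (i , q) , south , false , 2F) (next-prev q)
  α-involutive ((i , q) , south , true  , 0F) = cong (λ q → (i , q) , south , true , 0F) (prev-next q)
  α-involutive (c       , south , true  , 1F) = refl
  α-involutive (c       , south , true  , 2F) = refl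

  white-α : ∀ x → white (α x) ≢ white x
  white-α (_ , north , true  , 0F) ()
  white-α (_ , north , true  , 1F) ()
  white-α (_ , north , true  , 2F) ()
  white-α (_ , north , false , 0F) ()
  white-α (_ , north , false , 1F) ()
  white-α (_ , north , false , 2F) ()
  white-α (_ , south , false , 0F) ()
  white-α (_ , south , false , 1F) ()
  white-α (_ , south , false , 2F) ()
  white-α (_ , south , true  , 0F) ()
  white-α (_ , south , true  , 1F) ()
  white-α (_ , south , true  , 2F) ()

  α-fpf : ∀ x → α x ≢ x
  α-fpf x αx≡x = white-α x (cong white αx≡x)

  a-carry : ∀ i r → a (carry i r) ≡ a (i , r)
  a-carry i zero    = refl
  a-carry i (suc j) = refl

  vert-σ : ∀ x → vert (σ x) ≡ vert x
  vert-σ (c       , north , true  , 0F) = refl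
  vert-σ (c       , north , true  , 1F) = refl
  vert-σ (c       , north , true  , 2F) = refl
  vert-σ (c       , north , false , 0F) = refl
  vert-σ (c       , north , false , 1F) = refl
  vert-σ ((i , q) , north , false , 2F) = a-carry i (next q)
  vert-σ (c       , south , false , 0F) = refl
  vert-σ (c       , south , false , 1F) = refl
  vert-σ ((i , q) , south , false , 2F) = cong (λ r → a (i , r)) (next-prev q)
  vert-σ (c       , south , true  , 0F) = refl
  vert-σ (c       , south , true  , 1F) = refl
  vert-σ (c       , south , true  , 2F) = refl

  cell₀ : Cell
  cell₀ = zero , zero

  corner : Vertex → Dart
  corner N        = cell₀ , north , true , 0F
  corner A        = cell₀ , north , true , 1F
  corner (b c)    = c , north , true , 2F
  corner (S i)    = (i , zero) , south , false , 0F
  corner (a-suc i j) = (i , suc j) , north , true , 1F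

  vert-corner : ∀ v → vert (corner v) ≡ v
  vert-corner N        = refl
  vert-corner A        = refl
  vert-corner (b c)    = refl
  vert-corner (S i)    = refl
  vert-corner (a-suc i j) = refl

  private
    _⟶_ : Dart → Dart → Set
    _⟶_ = Path σ

    N-dart : Cell → Dart
    N-dart c = c , north , true , 0F

    A-dart : Fin (suc k) → Dart
    A-dart i = (i , zero) , north , true , 1F

    S-dart : (i : Fin (suc k)) → Fin (suc (p i)) → Dart
    S-dart i q = (i , q) , south , false , 0F

    north-step : ∀ c → N-dart c ⟶ N-dart (prevCell c)
    north-step c = refl ◅ refl ◅ ε

    north-path-petal : ∀ i q → N-dart (i , q) ⟶ N-dart (i , zero)
    north-path-petal i = <-weakInduction (λ q → N-dart (i , q) ⟶ N-dart (i , zero))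
      ε (λ j path → north-step (i , suc j) ◅◅ path)

    north-path : ∀ c → N-dart c ⟶ N-dart cell₀
    north-path (i , q) = north-path-petal i q ◅◅ <-weakInduction (λ i → N-dart (i , zero) ⟶ N-dart cell₀)
      ε (λ j path → north-step (suc j , zero) ◅◅ north-path-petal (inject₁ j) _ ◅◅ path) i

    A-step : ∀ i → A-dart i ⟶ A-dart (next i)
    A-step i = refl ◅ refl ◅ refl ◅ cong (λ r → carry i r , north , true , 1F) (next-fromℕ (p i)) ◅ ε

    A-path : ∀ i → A-dart i ⟶ corner A
    A-path = >-weakInduction (λ i → A-dart i ⟶ A-dart zero)
      (subst (λ j → A-dart (fromℕ k) ⟶ A-dart j) (next-fromℕ k) (A-step (fromℕ k)))
      (λ j path → subst (λ j′ → A-dart (inject₁ j) ⟶ A-dart j′) (next-inject₁ j) (A-step (inject₁ j))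
                  ◅◅ path)

    a-path : ∀ c → (c , north , true , 1F) ⟶ corner (a c)
    a-path (i , zero)  = A-path i
    a-path (i , suc j) = ε

    carry-path : ∀ i r → (carry i r , north , true , 1F) ⟶ corner (a (i , r))
    carry-path i zero    = A-path (next i)
    carry-path i (suc j) = ε

    south-step : ∀ i q → S-dart i q ⟶ S-dart i (next q)
    south-step i q = refl ◅ refl ◅ ε

    south-path : ∀ i q → S-dart i q ⟶ S-dart i zero
    south-path i = >-weakInduction (λ q → S-dart i q ⟶ S-dart i zero)
      (subst (λ r → S-dart i (fromℕ (p i)) ⟶ S-dart i r) (next-fromℕ (p i)) (south-step i (fromℕ (p i))))
      (λ j path → subst (λ r → S-dart i (inject₁ j) ⟶ S-dart i r) (next-inject₁ j) (south-step i (inject₁ j))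
                  ◅◅ path)

  rotate-to-corner : ∀ x → Path σ x (corner (vert x))
  rotate-to-corner (c       , north , true  , 0F) = north-path c
  rotate-to-corner (c       , north , true  , 1F) = a-path c
  rotate-to-corner (c       , north , true  , 2F) = ε
  rotate-to-corner (c       , north , false , 0F) = refl ◅ north-path c
  rotate-to-corner (c       , north , false , 1F) = refl ◅ refl ◅ refl ◅ ε
  rotate-to-corner ((i , q) , north , false , 2F) = refl ◅ carry-path i (next q)
  rotate-to-corner ((i , q) , south , false , 0F) = south-path i q
  rotate-to-corner (c       , south , false , 1F) = refl ◅ ε
  rotate-to-corner ((i , q) , south , false , 2F) =
    refl ◅ refl ◅ cong (λ r → carry i r , north , true , 1F) (next-prev q) ◅ carry-path i q
  rotate-to-corner ((i , q) , south , true  , 0F) = refl ◅ south-path i (next q)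
  rotate-to-corner ((i , q) , south , true  , 1F) = refl ◅ refl ◅ carry-path i (next q)
  rotate-to-corner (c       , south , true  , 2F) = refl ◅ refl ◅ ε

  private
    _⇝_ : Dart → Dart → Set
    _⇝_ = Star (λ y z → φ y ≡ z ⊎ α y ≡ z)

    σ-path⇒⇝ : ∀ {x y} → Path σ x y → x ⇝ y
    σ-path⇒⇝ ε          = ε
    σ-path⇒⇝ (refl ◅ q) = inj₂ refl ◅ inj₁ refl ◅ σ-path⇒⇝ q

    N-reach-root : ∀ c w → (c , north , w , 0F) ⇝ N-dart cell₀
    N-reach-root c true  = σ-path⇒⇝ (rotate-to-corner (c , north , true , 0F))
    N-reach-root c false = σ-path⇒⇝ (rotate-to-corner (c , north , false , 0F))

    north-reach-root : ∀ c w corner → (c , north , w , corner) ⇝ N-dart cell₀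
    north-reach-root c w 0F = N-reach-root c w
    north-reach-root c w 1F = inj₁ refl ◅ inj₁ refl ◅ N-reach-root c w
    north-reach-root c w 2F = inj₁ refl ◅ N-reach-root c w

    south-edge-reach-root : ∀ c w → (c , south , w , 1F) ⇝ N-dart cell₀
    south-edge-reach-root c true  = inj₂ refl ◅ north-reach-root c false 1F
    south-edge-reach-root c false = inj₂ refl ◅ north-reach-root c true 1F

    south-reach-root : ∀ c w corner → (c , south , w , corner) ⇝ N-dart cell₀
    south-reach-root c w 0F = inj₁ refl ◅ south-edge-reach-root c w
    south-reach-root c w 1F = south-edge-reach-root c w
    south-reach-root c w 2F = inj₁ refl ◅ inj₁ refl ◅ south-edge-reach-root c w

  reach-root : ∀ x → x ⇝ N-dart cell₀
  reach-root (c , north , w , corner) = north-reach-root c w corner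
  reach-root (c , south , w , corner) = south-reach-root c w corner

  bouquet : F2CTriangulationOn Dart Vertex
  bouquet = record
    { φ                = φ
    ; α                = α
    ; φ³≡id            = φ³≡id
    ; φ-fpf            = φ-fpf
    ; α-involutive     = α-involutive
    ; α-fpf            = α-fpf
    ; vert             = vert
    ; vert-σ           = vert-σ
    ; corner           = corner
    ; vert-corner      = vert-corner
    ; rotate-to-corner = rotate-to-corner
    ; root             = N-dart cell₀
    ; reach-root       = reach-root
    ; white            = white
    ; white-φ          = λ _ → refl
    ; white-α          = white-α
    }

  cells : ℕ
  cells = ∑ℕ (suc ∘ p)

  -- opaque: unifying vertex classes ⟦ v ⟧ would otherwise unfold these encodings, which is very slow
  opaque
    Dart↔ : Dart ↔ Fin (cells ℕ.* 12)
    Dart↔ = ↔-trans (Σ-Fin↔ (suc ∘ p) ×-↔ Location↔) (↔-sym *↔×)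

    Vertex↔ : Vertex ↔ Fin (2 ℕ.+ cells ℕ.* 2)
    Vertex↔ = ↔-trans (↔-refl ⊎-↔ ↔-trans (Σ-Fin↔ (suc ∘ p) ×-↔ ↔-sym 2↔Bool) (↔-sym *↔×))
                      (↔-sym +↔⊎)

  euler : 6 ℕ.* (2 ℕ.+ cells ℕ.* 2) ≡ cells ℕ.* 12 ℕ.+ 12
  euler = arithmetic cells
    where arithmetic : ∀ m → 6 ℕ.* (2 ℕ.+ m ℕ.* 2) ≡ m ℕ.* 12 ℕ.+ 12
          arithmetic = ℕ-RingSolver.solve-∀


-- Its canonical group

combination : ∀ {n g} → ℤ^ g → ℤ^ g → (Fin n → ℤ^ g) → Fin n × ℤ × ℤ × ℤ → ℤ^ g
combination u v w (i , x , y , z) = x · u ⊕ y · v ⊕ z · w i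

linear-combination : ∀ {g g′ n} (F : Fin g → ℤ^ g′) u v (w : Fin n → ℤ^ g) c →
                     linear F (combination u v w c) ≗ combination (linear F u) (linear F v) (linear F ∘ w) c
linear-combination F u v w (i , x , y , z) j =
  trans (linear-⊕ F (x · u ⊕ y · v) (z · w i) j)
        (cong₂ _+_ (trans (linear-⊕ F (x · u) (y · v) j) (cong₂ _+_ (linear-· F x u j) (linear-· F y v j)))
                   (linear-· F z (w i) j))

combination-≈ : ∀ {g r n} {R : Fin r → ℤ^ g} {u u′ v v′} {w w′ : Fin n → ℤ^ g} →
                u ≈[ R ] u′ → v ≈[ R ] v′ → (∀ i → w i ≈[ R ] w′ i) →
                ∀ c → combination u v w c ≈[ R ] combination u′ v′ w′ c
combination-≈ u≈ v≈ w≈ (i , x , y , z) = ≈-⊕ (≈-⊕ (≈-· x u≈) (≈-· y v≈)) (≈-· z (w≈ i))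

module CanonicalGroup {k : ℕ} (m : Fin k → ℕ) (m>0 : ∀ l → 0 < m l) where

  -- petal 0 is a single cell; it forces S₀ = N and makes the construction work for k = 0
  p : Fin (suc k) → ℕ
  p zero    = 0
  p (suc l) = ℕ.pred (m l)

  suc-p : ∀ l → suc (p (suc l)) ≡ m l
  suc-p l = suc-pred (m l) {{>-nonZero (m>0 l)}}

  open Bouquet p
  open Transport Dart↔ Vertex↔ bouquet
  private module W = Inverse Vertex↔

  T : F2CTriangulation
  T = toF2CTriangulation euler

  V : ℕ
  V = 2 ℕ.+ cells ℕ.* 2

  R : Fin (cells ℕ.* 12) → ℤ^ V
  R = F2CTriangulation.whiteRel T

  R′ : Fin k → ℤ^ (2 ℕ.+ k)
  R′ l = ℤ.+ (m l) · unit (suc (suc l))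

  infix 4 _≈_ _≈′_
  _≈_ : ℤ^ V → ℤ^ V → Set
  _≈_ = _≈[ R ]_
  _≈′_ : ℤ^ (2 ℕ.+ k) → ℤ^ (2 ℕ.+ k) → Set
  _≈′_ = _≈[ R′ ]_

  open SetoidReasoning (≈-setoid {R = R})

  Δ : Fin (suc k) → ℤ^ V
  Δ i = ⟦ N ⟧ ⊖ ⟦ S i ⟧

  north-face : ∀ c → InSpan R (⟦ N ⟧ ⊕ (⟦ a c ⟧ ⊕ ⟦ b c ⟧))
  north-face c = faceRelation∈span euler (c , north , true , 0F)

  south-face : ∀ c → InSpan R (⟦ S (proj₁ c) ⟧ ⊕ (⟦ a-next c ⟧ ⊕ ⟦ b c ⟧))
  south-face c = faceRelation∈span euler (c , south , true , 0F)

  b-class : ∀ c → ⟦ b c ⟧ ≈ ⊝ (⟦ N ⟧ ⊕ ⟦ a c ⟧)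
  b-class c = mk≈ $ span-≗ (λ w → rearrange (⟦ N ⟧ w) (⟦ a c ⟧ w) (⟦ b c ⟧ w)) (north-face c)
    where rearrange : ∀ n a b → n + (a + b) ≡ b - - (n + a)
          rearrange = solve-∀

  a-step : ∀ i q → ⟦ a-next (i , q) ⟧ ≈ ⟦ a (i , q) ⟧ ⊕ Δ i
  a-step i q = mk≈ $ span-≗ (λ w → rearrange (⟦ N ⟧ w) (⟦ S i ⟧ w) (⟦ a (i , q) ⟧ w)
                                             (⟦ a-next (i , q) ⟧ w) (⟦ b (i , q) ⟧ w))
                            (span-⊕ (south-face (i , q)) (span-⊝ (north-face (i , q))))
    where rearrange : ∀ n s a a′ b → (s + (a′ + b)) + - (n + (a + b)) ≡ a′ - (a + (n - s))
          rearrange = solve-∀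

  private
    step-formula : ∀ x n d → x + n * d + d ≡ x + (1ℤ + n) * d
    step-formula = solve-∀

  a-formula : ∀ i q → ⟦ a (i , q) ⟧ ≈ ⟦ A ⟧ ⊕ ℤ.+ toℕ q · Δ i
  a-formula i = <-weakInduction (λ q → ⟦ a (i , q) ⟧ ≈ ⟦ A ⟧ ⊕ ℤ.+ toℕ q · Δ i)
    (≗⇒≈ λ w → sym (+-identityʳ (⟦ A ⟧ w)))
    (λ j IH → begin
      ⟦ a (i , suc j) ⟧                       ≡⟨ cong (λ r → ⟦ a (i , r) ⟧) (next-inject₁ j) ⟨
      ⟦ a-next (i , inject₁ j) ⟧              ≈⟨ a-step i (inject₁ j) ⟩
      ⟦ a (i , inject₁ j) ⟧ ⊕ Δ i             ≈⟨ ≈-⊕ IH ≈-refl ⟩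
      ⟦ A ⟧ ⊕ ℤ.+ toℕ (inject₁ j) · Δ i ⊕ Δ i ≡⟨ cong (λ n → ⟦ A ⟧ ⊕ ℤ.+ n · Δ i ⊕ Δ i) (toℕ-inject₁ j) ⟩
      ⟦ A ⟧ ⊕ ℤ.+ toℕ j · Δ i ⊕ Δ i           ≈⟨ ≗⇒≈ (λ w → step-formula (⟦ A ⟧ w) (ℤ.+ toℕ j) (Δ i w)) ⟩
      ⟦ A ⟧ ⊕ ℤ.+ toℕ (suc j) · Δ i           ∎)

  petal-relation : ∀ i → ℤ.+ suc (p i) · Δ i ≈ 0ᵛ
  petal-relation i = begin
    ℤ.+ suc (p i) · Δ i                 ≈⟨ ≗⇒≈ (λ w → rearrange (⟦ A ⟧ w) (ℤ.+ suc (p i) * Δ i w)) ⟩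
    ⟦ A ⟧ ⊕ ℤ.+ suc (p i) · Δ i ⊖ ⟦ A ⟧ ≈⟨ ≈-⊕ (≈-sym A-around-petal) ≈-refl ⟩
    ⟦ A ⟧ ⊖ ⟦ A ⟧                       ≈⟨ ≗⇒≈ (λ w → +-inverseʳ (⟦ A ⟧ w)) ⟩
    0ᵛ                                  ∎
    where
      rearrange : ∀ x y → y ≡ x + y - x
      rearrange = solve-∀
      top = fromℕ (p i)
      A-around-petal : ⟦ A ⟧ ≈ ⟦ A ⟧ ⊕ ℤ.+ suc (p i) · Δ i
      A-around-petal = begin
        ⟦ A ⟧                           ≡⟨ cong (λ r → ⟦ a (i , r) ⟧) (next-fromℕ (p i)) ⟨
        ⟦ a-next (i , top) ⟧            ≈⟨ a-step i top ⟩
        ⟦ a (i , top) ⟧ ⊕ Δ i           ≈⟨ ≈-⊕ (a-formula i top) ≈-refl ⟩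
        ⟦ A ⟧ ⊕ ℤ.+ toℕ top · Δ i ⊕ Δ i ≡⟨ cong (λ n → ⟦ A ⟧ ⊕ ℤ.+ n · Δ i ⊕ Δ i) (toℕ-fromℕ (p i)) ⟩
        ⟦ A ⟧ ⊕ ℤ.+ p i · Δ i ⊕ Δ i     ≈⟨ ≗⇒≈ (λ w → step-formula (⟦ A ⟧ w) (ℤ.+ p i) (Δ i w)) ⟩
        ⟦ A ⟧ ⊕ ℤ.+ suc (p i) · Δ i     ∎

  Δ₀≈0 : Δ zero ≈ 0ᵛ
  Δ₀≈0 = ≈-trans (≗⇒≈ (λ w → sym (*-identityˡ (Δ zero w)))) (petal-relation zero)

  coordinates : Vertex → Fin (suc k) × ℤ × ℤ × ℤ
  coordinates N           = zero , 1ℤ , 0ℤ , 0ℤ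
  coordinates A           = zero , 0ℤ , 1ℤ , 0ℤ
  coordinates (b (i , q)) = i , -1ℤ , -1ℤ , - ℤ.+ toℕ q
  coordinates (S i)       = i , 1ℤ , 0ℤ , -1ℤ
  coordinates (a-suc i j) = i , 0ℤ , 1ℤ , ℤ.+ toℕ (suc j)

  vertex-class : ∀ u → ⟦ u ⟧ ≈ combination ⟦ N ⟧ ⟦ A ⟧ Δ (coordinates u)
  vertex-class N           = ≗⇒≈ λ w → ring (⟦ N ⟧ w) (⟦ A ⟧ w) (Δ zero w)
    where ring : ∀ n a d → n ≡ 1ℤ * n + 0ℤ * a + 0ℤ * d
          ring = solve-∀
  vertex-class A           = ≗⇒≈ λ w → ring (⟦ N ⟧ w) (⟦ A ⟧ w) (Δ zero w)
    where ring : ∀ n a d → a ≡ 0ℤ * n + 1ℤ * a + 0ℤ * d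
          ring = solve-∀
  vertex-class (b (i , q)) = begin
    ⟦ b (i , q) ⟧                                       ≈⟨ b-class (i , q) ⟩
    ⊝ (⟦ N ⟧ ⊕ ⟦ a (i , q) ⟧)                           ≈⟨ ≈-⊝ (≈-⊕ (≈-refl {x = ⟦ N ⟧}) (a-formula i q)) ⟩
    ⊝ (⟦ N ⟧ ⊕ (⟦ A ⟧ ⊕ ℤ.+ toℕ q · Δ i))               ≈⟨ ≗⇒≈ (λ w → ring (⟦ N ⟧ w) (⟦ A ⟧ w) (ℤ.+ toℕ q) (Δ i w)) ⟩
    combination ⟦ N ⟧ ⟦ A ⟧ Δ (coordinates (b (i , q))) ∎
    where ring : ∀ n a x d → - (n + (a + x * d)) ≡ -1ℤ * n + -1ℤ * a + - x * d
          ring = solve-∀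
  vertex-class (S i)       = ≗⇒≈ λ w → ring (⟦ N ⟧ w) (⟦ A ⟧ w) (⟦ S i ⟧ w)
    where ring : ∀ n a s → s ≡ 1ℤ * n + 0ℤ * a + -1ℤ * (n - s)
          ring = solve-∀
  vertex-class (a-suc i j) =
    ≈-trans (a-formula i (suc j)) (≗⇒≈ λ w → ring (⟦ N ⟧ w) (⟦ A ⟧ w) (ℤ.+ toℕ (suc j)) (Δ i w))
    where ring : ∀ n a x d → a + x * d ≡ 0ℤ * n + 1ℤ * a + x * d
          ring = solve-∀

  τ : Fin (suc k) → ℤ^ (2 ℕ.+ k)
  τ zero    = 0ᵛ
  τ (suc l) = unit (suc (suc l))

  image : Vertex → ℤ^ (2 ℕ.+ k)
  image u = combination (unit 0F) (unit 1F) τ (coordinates u)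

  f : Fin V → ℤ^ (2 ℕ.+ k)
  f = image ∘ W.from

  h : Fin (2 ℕ.+ k) → ℤ^ V
  h 0F            = ⟦ N ⟧
  h 1F            = ⟦ A ⟧
  h (suc (suc l)) = Δ (suc l)

  h-τ : ∀ i → linear h (τ i) ≈ Δ i
  h-τ zero    = ≈-trans (≗⇒≈ (linear-0 h)) (≈-sym Δ₀≈0)
  h-τ (suc l) = ≗⇒≈ (linear-unit h (suc (suc l)))

  h-image : ∀ u → linear h (image u) ≈ ⟦ u ⟧
  h-image u = begin
    linear h (image u)
      ≈⟨ ≗⇒≈ (linear-combination h (unit 0F) (unit 1F) τ (coordinates u)) ⟩
    combination (linear h (unit 0F)) (linear h (unit 1F)) (linear h ∘ τ) (coordinates u)
      ≈⟨ combination-≈ (≗⇒≈ (linear-unit h 0F)) (≗⇒≈ (linear-unit h 1F)) h-τ (coordinates u) ⟩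
    combination ⟦ N ⟧ ⟦ A ⟧ Δ (coordinates u)
      ≈⟨ vertex-class u ⟨
    ⟦ u ⟧
      ∎

  h-f : ∀ v → linear h (f v) ≈ unit v
  h-f v = subst (λ x → linear h (f v) ≈ unit x) (W.strictlyInverseˡ v) (h-image (W.from v))

  h-relations : ∀ l → InSpan R (linear h (R′ l))
  h-relations l = ≈0⇒InSpan (begin
    linear h (R′ l)                 ≈⟨ ≗⇒≈ (λ w → trans (linear-· h (ℤ.+ m l) (unit (suc (suc l))) w)
                                                      (cong (ℤ.+ m l *_) (linear-unit h (suc (suc l)) w))) ⟩
    ℤ.+ m l · Δ (suc l)             ≡⟨ cong (λ n → ℤ.+ n · Δ (suc l)) (suc-p l) ⟨
    ℤ.+ suc (p (suc l)) · Δ (suc l) ≈⟨ petal-relation (suc l) ⟩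
    0ᵛ                              ∎)

  f-⟦⟧ : ∀ u → linear f ⟦ u ⟧ ≗ image u
  f-⟦⟧ u j = trans (linear-unit f (W.to u) j) (cong (λ v → image v j) (W.strictlyInverseʳ u))

  f-h : ∀ e → linear f (h e) ≈′ unit e
  f-h 0F            = ≗⇒≈ λ j → trans (f-⟦⟧ N j) (ring (unit 0F j) (unit 1F j))
    where ring : ∀ e₀ e₁ → 1ℤ * e₀ + 0ℤ * e₁ + 0ℤ * 0ℤ ≡ e₀
          ring = solve-∀
  f-h 1F            = ≗⇒≈ λ j → trans (f-⟦⟧ A j) (ring (unit 0F j) (unit 1F j))
    where ring : ∀ e₀ e₁ → 0ℤ * e₀ + 1ℤ * e₁ + 0ℤ * 0ℤ ≡ e₁
          ring = solve-∀
  f-h (suc (suc l)) = ≗⇒≈ λ j →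
    trans (linear-⊖ f ⟦ N ⟧ ⟦ S (suc l) ⟧ j)
          (trans (cong₂ _-_ (f-⟦⟧ N j) (f-⟦⟧ (S (suc l)) j)) (ring (unit 0F j) (unit 1F j) (unit (suc (suc l)) j)))
    where ring : ∀ e₀ e₁ t → (1ℤ * e₀ + 0ℤ * e₁ + 0ℤ * 0ℤ) - (1ℤ * e₀ + 0ℤ * e₁ + -1ℤ * t) ≡ t
          ring = solve-∀

  τ-order : ∀ i → InSpan R′ (ℤ.+ suc (p i) · τ i)
  τ-order zero    = span-≗ (λ _ → refl) span-0
  τ-order (suc l) = span-≗ (λ j → cong (λ n → ℤ.+ n * unit (suc (suc l)) j) (sym (suc-p l))) (span-gen l)

  image-a : ∀ i q → image (a (i , q)) ≗ combination (unit 0F) (unit 1F) τ (i , 0ℤ , 1ℤ , ℤ.+ toℕ q)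
  image-a i zero    j = ring (unit 0F j) (unit 1F j) (τ i j)
    where ring : ∀ e₀ e₁ t → 0ℤ * e₀ + 1ℤ * e₁ + 0ℤ * 0ℤ ≡ 0ℤ * e₀ + 1ℤ * e₁ + 0ℤ * t
          ring = solve-∀
  image-a i (suc q) j = refl

  f-triangle : ∀ u v w → linear f (⟦ u ⟧ ⊕ (⟦ v ⟧ ⊕ ⟦ w ⟧)) ≗ image u ⊕ (image v ⊕ image w)
  f-triangle u v w j = trans (linear-⊕ f ⟦ u ⟧ (⟦ v ⟧ ⊕ ⟦ w ⟧) j)
    (cong₂ _+_ (f-⟦⟧ u j) (trans (linear-⊕ f ⟦ v ⟧ ⟦ w ⟧ j) (cong₂ _+_ (f-⟦⟧ v j) (f-⟦⟧ w j))))

  north-image : ∀ c → linear f (⟦ N ⟧ ⊕ (⟦ a c ⟧ ⊕ ⟦ b c ⟧)) ≗ 0ᵛ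
  north-image (i , q) j = trans (f-triangle N (a (i , q)) (b (i , q)) j)
    (trans (cong (λ x → image N j + (x + image (b (i , q)) j)) (image-a i q j))
           (ring (unit 0F j) (unit 1F j) (ℤ.+ toℕ q) (τ i j)))
    where ring : ∀ e₀ e₁ n t → (1ℤ * e₀ + 0ℤ * e₁ + 0ℤ * 0ℤ)
                                 + ((0ℤ * e₀ + 1ℤ * e₁ + n * t) + (-1ℤ * e₀ + -1ℤ * e₁ + - n * t)) ≡ 0ℤ
          ring = solve-∀

  -- going once around petal i leaves (1 + p i) τ i, a relation of the target group
  south-image : ∀ i q → InSpan R′ (linear f (⟦ S i ⟧ ⊕ (⟦ a-next (i , q) ⟧ ⊕ ⟦ b (i , q) ⟧)))
  south-image i q =
    span-≗ (λ j → sym (trans (f-triangle (S i) (a-next (i , q)) (b (i , q)) j)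
                             (cong (λ x → image (S i) j + (x + image (b (i , q)) j)) (image-a i (next q) j))))
           (by-cases (toℕ-next q))
    where
      face-sum : ℕ → ℤ^ (2 ℕ.+ k)
      face-sum n = image (S i) ⊕ (combination (unit 0F) (unit 1F) τ (i , 0ℤ , 1ℤ , ℤ.+ n) ⊕ image (b (i , q)))
      inside : ∀ e₀ e₁ n t → (1ℤ * e₀ + 0ℤ * e₁ + -1ℤ * t)
                               + ((0ℤ * e₀ + 1ℤ * e₁ + (1ℤ + n) * t) + (-1ℤ * e₀ + -1ℤ * e₁ + - n * t)) ≡ 0ℤ
      inside = solve-∀
      wrapping : ∀ e₀ e₁ n t → - ((1ℤ + n) * t) ≡ (1ℤ * e₀ + 0ℤ * e₁ + -1ℤ * t)
                                 + ((0ℤ * e₀ + 1ℤ * e₁ + 0ℤ * t) + (-1ℤ * e₀ + -1ℤ * e₁ + - n * t))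
      wrapping = solve-∀
      by-cases : (next q ≡ zero × toℕ q ≡ p i) ⊎ toℕ (next q) ≡ suc (toℕ q) → InSpan R′ (face-sum (toℕ (next q)))
      by-cases (inj₂ eq) rewrite eq =
        span-≗ (λ j → sym (inside (unit 0F j) (unit 1F j) (ℤ.+ toℕ q) (τ i j))) span-0
      by-cases (inj₁ (eq , toℕq≡p)) rewrite eq =
        span-≗ (λ j → subst (λ n → - (ℤ.+ suc n * τ i j) ≡ face-sum 0 j) toℕq≡p
                            (wrapping (unit 0F j) (unit 1F j) (ℤ.+ toℕ q) (τ i j)))
               (span-⊝ (τ-order i))

  private
    image-faceRelation₀ : ∀ c pole w → InSpan R′ (linear f (faceRelation (c , pole , w , 0F)))
    image-faceRelation₀ c       north true  = span-≗ (λ j → sym (north-image c j)) span-0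
    image-faceRelation₀ (i , q) south true  = south-image i q
    image-faceRelation₀ c       pole  false = span-≗ (λ j → sym (linear-0 f j)) span-0

    image-faceRelation : ∀ y → InSpan R′ (linear f (faceRelation y))
    image-faceRelation (c , pole , w , 0F) = image-faceRelation₀ c pole w
    image-faceRelation (c , pole , w , 1F) =
      span-≗ (λ j → sym (linear-cong f (faceRelation-φ (c , pole , w , 0F)) j)) (image-faceRelation₀ c pole w)
    image-faceRelation (c , pole , w , 2F) =
      span-≗ (λ j → sym (linear-cong f (λ i → trans (faceRelation-φ (c , pole , w , 1F) i)
                                                    (faceRelation-φ (c , pole , w , 0F) i)) j))
             (image-faceRelation₀ c pole w)

  f-relations : ∀ j → InSpan R′ (linear f (R j))
  f-relations j = span-≗ (λ i → sym (linear-cong f (whiteRel≗faceRelation euler j) i))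
                         (image-faceRelation (Inverse.from Dart↔ j))

  canonical-group : F2CTriangulation.𝒜W T ≅ Z²⊕cyclics k m
  canonical-group = Presented-≅ f h f-relations h-relations h-f f-h

proposition2p8 : (k : ℕ) (m : Fin k → ℕ) → (∀ i → 0 < m i) →
    ∃ λ (T : F2CTriangulation) → F2CTriangulation.𝒜W T ≅ Z²⊕cyclics k m
proposition2p8 k m m>0 = T , canonical-group
  where open CanonicalGroup m m>0
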